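{- Let $(\Phi,\mathfrak N,\mathfrak T,\mathfrak R,\mathfrak S,\phi_{\mathrm{start}},\Sigma,\mathrm{Lex},\mathrm{Sel})$ be a parameterized local lexing, $D\in\Sigma^*$, and suppose $(N^\alpha_\beta\to w)\in\overline{\mathfrak R}$ with $N\in\mathfrak N$. If $w$ ends with $\bot$ then $|w|\ge2$. Furthermore, for every $d$ with $0\le d\le|w|$ if $w$ does not end with $\bot$, and $0\le d\le|w|-2$ if $w$ ends with $\bot$, and for all $0\le i\le j\le|D|$, there is a parameterized item $x=(r,d,i,j,\rho)$ whose rule $r$ has left-hand side $N$ such that $(N^\alpha_\beta\to w,d,i,j)\in\overline x$.
   Context: $\Phi$ is a non-empty set; $\mathfrak N,\mathfrak T$ disjoint sets of nonterminals and terminals; $\mathfrak S\in\mathfrak N$, $\phi_{\mathrm{start}}\in\Phi$; $\mathfrak R$ a set of parameterized rules $N_{f_{k+1}}\to X_1^{f_1}\cdots X_k^{f_k}$ ($k\ge0$, $N\in\mathfrak N$, $X_i\in\mathfrak N\cup\mathfrak T$, partial $f_i:\Phi^{2i-1}\rightharpoonup\Phi$); $\Sigma,\mathrm{Lex},\mathrm{Sel}$ not needed here. Sequences indexed from 0; $\mathrm{take}_n$ takes the first $n$ entries. $\langle f_1,\dots,f_u\rangle$ is the set of $\rho\in\Phi^{2u}$ with $f_i$ defined at $(\rho_0,\dots,\rho_{2i-2})$ and $\rho_{2i-1}=f_i(\rho_0,\dots,\rho_{2i-2})$ for $i=1,\dots,u$. Induced grammar: nonterminals $(\mathfrak N\times\Phi\times\Phi)\cup\{\top,\bot\}$,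 terminals $\mathfrak T\times\Phi\times\Phi$, triples written $X^\alpha_\beta$; rules $\overline{\mathfrak R}=\{\top\to\mathfrak S^{\phi_{\mathrm{start}}}_\beta\mid\beta\in\Phi\}\cup\bigcup_{r\in\mathfrak R}\overline r$, where for $r=N_{f_{k+1}}\to X_1^{f_1}\cdots X_k^{f_k}$, $\overline r$ consists of (i) rules $N^\alpha_\beta\to(X_1)^{\alpha_1}_{\beta_1}\cdots(X_k)^{\alpha_k}_{\beta_k}$ with $(\alpha,\alpha_1,\beta_1,\dots,\alpha_k,\beta_k,\beta)\in\langle f_1,\dots,f_{k+1}\rangle$, and (ii) rules $N^\alpha_\beta\to(X_1)^{\alpha_1}_{\beta_1}\cdots(X_h)^{\alpha_h}_{\beta_h}\bot$ with $1\le h\le k$, $\beta,\beta_h\in\Phi$, $(\alpha,\alpha_1,\beta_1,\dots,\alpha_h)\in\langle f_1,\dots,f_h\rangle$ and $f_{h+1}$ undefined at $(\alpha,\alpha_1,\beta_1,\dots,\alpha_h,\beta_h)$. A parameterized item is $(r,d,i,j,\rho)$ with $r\in\mathfrak R$ having $k$ right-hand symbols, $0\le d\le k$, $0\le i\le j\le|D|$, $\rho\in\langle f_1,\dots,f_{d+1}\rangle$. An ordinary item is $(q,d,i,j)$ with $q=(L\to w)\in\overline{\mathfrak R}$, $0\le d\le|w|$, $0\le i\le j\le|D|$. For $x=(r,d,i,j,\rho)$, $\overline x$ consists of all $(q,d,i,j)$ with $q\in\overline r$ of type (i) and $\mathrm{take}_{2(d+1)}(\alpha,\alpha_1,\beta_1,\dots,\alpha_k,\beta_k,\beta)=\rho$,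 and all $(q,d,i,j)$ with $q\in\overline r$ of type (ii), $d\le h-1$, and $\mathrm{take}_{2(d+1)}(\alpha,\alpha_1,\beta_1,\dots,\alpha_h)=\rho$. -}

module Defs where

open import Data.Nat using (ℕ; zero; suc; _+_; _*_; _≤_; _<_; _≟_)
open import Data.Fin using (Fin; toℕ)
open import Data.List using (List; []; _∷_; _++_; length; take; drop; head)
open import Data.Vec using (Vec; fromList)
open import Data.Maybe using (Maybe; just; nothing)
open import Data.Sum using (_⊎_; inj₁; inj₂)
open import Data.Product using (Σ; _×_; ∃; _,_)
open import Relation.Nullary using (yes; no)
open import Relation.Binary.PropositionalEquality using (_≡_; subst)

-- Parameterized rules  N_{f_{k+1}} → X_1^{f_1} ⋯ X_k^{f_k}
-- Symbols X_i ∈ 𝔑 ∪ 𝔗 are elements of NT ⊎ T (so 𝔑, 𝔗 are disjoint).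
-- The field  f i  (i : Fin (k+1)) is the paper's f_{i+1}, of arity 2(i+1)-1 = 2i+1.

record Rule (Φ NT T : Set) : Set where
  constructor mkRule
  field
    lhs : NT
    rhs : List (NT ⊎ T)
    f   : (i : Fin (suc (length rhs))) → Vec Φ (suc (2 * toℕ i)) → Maybe Φ
open Rule public

-- apply a partial function of arity n to a finite sequence (nothing if
-- the sequence has the wrong length, which never happens in the uses below)
applyV : ∀ {Φ : Set} {n : ℕ} → (Vec Φ n → Maybe Φ) → List Φ → Maybe Φ
applyV {Φ} {n} g xs with length xs ≟ n
... | yes p = g (subst (Vec Φ) p (fromList xs))
... | no _  = nothing

-- ρ ∈ ⟨f_1, …, f_u⟩   (sequences indexed from 0)
InAngle : ∀ {Φ NT T} → Rule Φ NT T → ℕ → List Φ → Set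
InAngle {Φ} r u ρ =
  (u ≤ suc (length (rhs r))) × (length ρ ≡ 2 * u) ×
  ((i : Fin (suc (length (rhs r)))) → toℕ i < u →
     Σ Φ λ v → (applyV (f r i) (take (suc (2 * toℕ i)) ρ) ≡ just v)
             × (head (drop (suc (2 * toℕ i)) ρ) ≡ just v))

data INT (Φ NT : Set) : Set where
  node : NT → Φ → Φ → INT Φ NT
  ⊤ₙ   : INT Φ NT
  ⊥ₙ   : INT Φ NT

data ISym (Φ NT T : Set) : Set where
  nonterm : INT Φ NT → ISym Φ NT T
  term    : T → Φ → Φ → ISym Φ NT T

lift : ∀ {Φ NT T} → NT ⊎ T → Φ → Φ → ISym Φ NT T
lift (inj₁ N) a b = nonterm (node N a b)
lift (inj₂ t) a b = term t a b

decorate : ∀ {Φ NT T} → List (NT ⊎ T) → List Φ → List (ISym Φ NT T)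
decorate []       _            = []
decorate (X ∷ Xs) (a ∷ b ∷ ps) = lift X a b ∷ decorate Xs ps
decorate (X ∷ Xs) _            = []

-- (L → w) ∈ r̄ of type (i), with underlying tuple t = (α,α_1,β_1,…,α_k,β_k,β)
TypeI : ∀ {Φ NT T} → Rule Φ NT T → List Φ → INT Φ NT → List (ISym Φ NT T) → Set
TypeI {Φ} r t L w =
  Σ Φ λ α → Σ (List Φ) λ mid → Σ Φ λ β →
    (t ≡ α ∷ (mid ++ β ∷ [])) × InAngle r (suc (length (rhs r))) t ×
    (L ≡ node (lhs r) α β) × (w ≡ decorate (rhs r) mid)

-- (L → w) ∈ r̄ of type (ii), with index h (1 ≤ h ≤ k, here h : Fin (k+1),
-- so that f_{h+1} is  f r h) and underlying tuple τ = (α,α_1,β_1,…,α_h)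
TypeII : ∀ {Φ NT T} (r : Rule Φ NT T) → Fin (suc (length (rhs r))) → List Φ →
         INT Φ NT → List (ISym Φ NT T) → Set
TypeII {Φ} r h τ L w =
  (1 ≤ toℕ h) ×
  (Σ Φ λ α → Σ (List Φ) λ mid → Σ Φ λ αh → Σ Φ λ βh → Σ Φ λ β →
    (τ ≡ α ∷ (mid ++ αh ∷ [])) × InAngle r (toℕ h) τ ×
    (applyV (f r h) (τ ++ βh ∷ []) ≡ nothing) ×
    (L ≡ node (lhs r) α β) ×
    (w ≡ decorate (take (toℕ h) (rhs r)) (mid ++ αh ∷ βh ∷ []) ++ nonterm ⊥ₙ ∷ []))

-- Parameterized local lexing (the components Lex and Sel are not needed
-- for this statement and are omitted; Σ is the type Alph).

record PLL : Set₁ where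
  field
    Φ      : Set
    NT     : Set
    T      : Set
    S      : NT
    φstart : Φ
    ℜ      : Rule Φ NT T → Set
    Alph   : Set
open PLL public

InducedRule : (G : PLL) → INT (Φ G) (NT G) → List (ISym (Φ G) (NT G) (T G)) → Set
InducedRule G L w =
  ((L ≡ ⊤ₙ) × (Σ (Φ G) λ β → w ≡ nonterm (node (S G) (φstart G) β) ∷ []))
  ⊎ (Σ (Rule (Φ G) (NT G) (T G)) λ r → ℜ G r ×
       ((Σ (List (Φ G)) λ t → TypeI r t L w)
        ⊎ (Σ (Fin (suc (length (rhs r)))) λ h → Σ (List (Φ G)) λ τ → TypeII r h τ L w)))

EndsBot : ∀ {Φ NT T} → List (ISym Φ NT T) → Set
EndsBot {Φ} {NT} {T} w = Σ (List (ISym Φ NT T)) λ u → w ≡ u ++ nonterm ⊥ₙ ∷ []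

record PItem (G : PLL) (D : List (Alph G)) : Set where
  constructor mkP
  field
    r   : Rule (Φ G) (NT G) (T G)
    r∈  : ℜ G r
    d   : ℕ
    d≤  : d ≤ length (rhs r)
    i   : ℕ
    j   : ℕ
    i≤j : i ≤ j
    j≤  : j ≤ length D
    ρ   : List (Φ G)
    ρ∈  : InAngle r (suc d) ρ

record OItem (G : PLL) (D : List (Alph G)) : Set where
  constructor mkO
  field
    L   : INT (Φ G) (NT G)
    w   : List (ISym (Φ G) (NT G) (T G))
    q∈  : InducedRule G L w
    d   : ℕ
    d≤  : d ≤ length w
    i   : ℕ
    j   : ℕ
    i≤j : i ≤ j
    j≤  : j ≤ length D

InBar : ∀ {G D} → OItem G D → PItem G D → Set
InBar {G} o x =
  (OItem.d o ≡ PItem.d x) × (OItem.i o ≡ PItem.i x) × (OItem.j o ≡ PItem.j x) ×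
  ((Σ (List (Φ G)) λ t → TypeI (PItem.r x) t (OItem.L o) (OItem.w o)
        × (take (2 * suc (PItem.d x)) t ≡ PItem.ρ x))
   ⊎ (Σ (Fin (suc (length (rhs (PItem.r x))))) λ h → Σ (List (Φ G)) λ τ →
        TypeII (PItem.r x) h τ (OItem.L o) (OItem.w o)
        × (PItem.d x < toℕ h)
        × (take (2 * suc (PItem.d x)) τ ≡ PItem.ρ x)))

-- An induced rule N^α_β → w comes from some r ∈ ℜ with an underlying tuple t. The
-- witness is x = (r, d, i, j, take_{2(d+1)} t), which is a parameterized item because
-- the sets ⟨f_1,…,f_u⟩ are closed under taking even-length prefixes. A type (i) rule
-- never ends with ⊥; a type (ii) rule has |w| = h + 1 with h ≥ 1, so |w| ≥ 2, and
-- d ≤ |w| − 2 gives d < h, the extra condition for membership in x̄.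
module Submission where

open import Defs
open import Data.Nat using (ℕ; suc; _+_; _*_; _≤_; _<_; z≤n; s≤s)
open import Data.Nat.Properties
  using (≤-trans; ≤-pred; <⇒≤; *-monoʳ-≤; *-suc; +-comm; m≤n⇒m⊓n≡m)
open import Data.List using (List; []; _∷_; _++_; length; take; drop; head)
open import Data.List.Properties using (length-++; length-++-≤ʳ; length-take; take-take)
open import Data.List.Membership.Propositional using (_∈_; _∉_)
open import Data.List.Membership.Propositional.Properties using (∈-++⁺ʳ)
open import Data.List.Relation.Unary.Any using (here; there)
open import Data.Fin using (Fin; toℕ)
open import Data.Fin.Properties using (toℕ<n)
open import Data.Product using (Σ; _×_; _,_)
open import Data.Sum using (_⊎_; inj₁; inj₂)
open import Data.Empty using (⊥-elim)
open import Relation.Nullary using (¬_)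
open import Relation.Binary.PropositionalEquality using (_≡_; _≢_; refl; sym; trans; cong; subst)

take-take-≤ : ∀ {A : Set} {m n} (xs : List A) → m ≤ n → take m (take n xs) ≡ take m xs
take-take-≤ {m = m} {n} xs m≤n = trans (take-take m n xs) (cong (λ k → take k xs) (m≤n⇒m⊓n≡m m≤n))

length-take-≡ : ∀ {A : Set} {n} (xs : List A) → n ≤ length xs → length (take n xs) ≡ n
length-take-≡ {n = n} xs n≤ = trans (length-take n xs) (m≤n⇒m⊓n≡m n≤)

head-drop-take : ∀ {A : Set} {m n} (xs : List A) → m < n →
                 head (drop m (take n xs)) ≡ head (drop m xs)
head-drop-take {m = 0}     []       (s≤s _)   = refl
head-drop-take {m = 0}     (x ∷ xs) (s≤s _)   = refl
head-drop-take {m = suc m} []       (s≤s _)   = refl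
head-drop-take {m = suc m} (x ∷ xs) (s≤s m<n) = head-drop-take xs m<n

length-∷ʳ : ∀ {A : Set} (xs : List A) (x : A) → length (xs ++ x ∷ []) ≡ suc (length xs)
length-∷ʳ xs x = trans (length-++ xs) (+-comm (length xs) 1)

InAngle-take : ∀ {Φ NT T} {r : Rule Φ NT T} {u m} {ρ : List Φ} →
               InAngle r u ρ → m ≤ u → InAngle r m (take (2 * m) ρ)
InAngle-take {r = r} {m = m} {ρ} (u≤ , length-ρ , graph) m≤u =
  ≤-trans m≤u u≤ ,
  length-take-≡ ρ (subst (2 * m ≤_) (sym length-ρ) (*-monoʳ-≤ 2 m≤u)) ,
  λ i i<m →
    let (v , value , entry) = graph i (≤-trans i<m m≤u)
        2i+1<2m : suc (2 * toℕ i) < 2 * m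
        2i+1<2m = subst (_≤ 2 * m) (*-suc 2 (toℕ i)) (*-monoʳ-≤ 2 i<m)
    in v ,
       trans (cong (applyV (f r i)) (take-take-≤ ρ (<⇒≤ 2i+1<2m))) value ,
       trans (head-drop-take ρ 2i+1<2m) entry

lift-≢-⊥ : ∀ {Φ NT T : Set} (X : NT ⊎ T) (a b : Φ) → lift X a b ≢ nonterm ⊥ₙ
lift-≢-⊥ (inj₁ _) _ _ ()
lift-≢-⊥ (inj₂ _) _ _ ()

⊥∉decorate : ∀ {Φ NT T : Set} (Xs : List (NT ⊎ T)) (ps : List Φ) →
             nonterm {T = T} ⊥ₙ ∉ decorate Xs ps
⊥∉decorate (X ∷ Xs) (a ∷ b ∷ ps) (here ⊥≡) = lift-≢-⊥ X a b (sym ⊥≡)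
⊥∉decorate (X ∷ Xs) (a ∷ b ∷ ps) (there ⊥∈) = ⊥∉decorate Xs ps ⊥∈

length-decorate-≤ : ∀ {Φ NT T : Set} (Xs : List (NT ⊎ T)) (ps : List Φ) →
                    length (decorate {T = T} Xs ps) ≤ length Xs
length-decorate-≤ []       _            = z≤n
length-decorate-≤ (X ∷ Xs) []           = z≤n
length-decorate-≤ (X ∷ Xs) (a ∷ [])     = z≤n
length-decorate-≤ (X ∷ Xs) (a ∷ b ∷ ps) = s≤s (length-decorate-≤ Xs ps)

decorate-nonempty : ∀ {Φ NT T : Set} (Xs : List (NT ⊎ T)) (ps : List Φ) →
                    0 < length Xs → 2 ≤ length ps → 0 < length (decorate {T = T} Xs ps)
decorate-nonempty (X ∷ Xs) (a ∷ b ∷ ps) _ _       = s≤s z≤n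
decorate-nonempty (X ∷ Xs) (a ∷ [])     _ (s≤s ())

TypeI-¬EndsBot : ∀ {Φ NT T} {r : Rule Φ NT T} {t L w} → TypeI r t L w → ¬ EndsBot w
TypeI-¬EndsBot {r = r} (_ , mid , _ , _ , _ , _ , refl) (u , w≡) =
  ⊥∉decorate (rhs r) mid (subst (nonterm ⊥ₙ ∈_) (sym w≡) (∈-++⁺ʳ u (here refl)))

rhs-prefix-length : ∀ {Φ NT T} (r : Rule Φ NT T) (h : Fin (suc (length (rhs r)))) →
                    length (take (toℕ h) (rhs r)) ≡ toℕ h
rhs-prefix-length r h = length-take-≡ (rhs r) (≤-pred (toℕ<n h))

TypeII-length-≥2 : ∀ {Φ NT T} {r : Rule Φ NT T} {h τ L w} → TypeII r h τ L w → 2 ≤ length w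
TypeII-length-≥2 {Φ} {NT} {T} {r} {h} (1≤h , _ , mid , αh , βh , _ , _ , _ , _ , _ , refl) =
  subst (2 ≤_) (sym (length-∷ʳ (decorate Xs ps) (nonterm ⊥ₙ)))
    (s≤s (decorate-nonempty Xs ps
      (subst (0 <_) (sym (rhs-prefix-length r h)) 1≤h)
      (length-++-≤ʳ (αh ∷ βh ∷ []) {mid})))
  where
  Xs : List (NT ⊎ T)
  Xs = take (toℕ h) (rhs r)
  ps : List Φ
  ps = mid ++ αh ∷ βh ∷ []

TypeII-length-≤ : ∀ {Φ NT T} {r : Rule Φ NT T} {h τ L w} → TypeII r h τ L w →
                  length w ≤ suc (toℕ h)
TypeII-length-≤ {Φ} {NT} {T} {r} {h} (_ , _ , mid , αh , βh , _ , _ , _ , _ , _ , refl) =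
  subst (_≤ suc (toℕ h)) (sym (length-∷ʳ (decorate Xs ps) (nonterm ⊥ₙ)))
    (s≤s (subst (length (decorate Xs ps) ≤_) (rhs-prefix-length r h) (length-decorate-≤ Xs ps)))
  where
  Xs : List (NT ⊎ T)
  Xs = take (toℕ h) (rhs r)
  ps : List Φ
  ps = mid ++ αh ∷ βh ∷ []

TypeII-EndsBot : ∀ {Φ NT T} {r : Rule Φ NT T} {h τ L w} → TypeII r h τ L w → EndsBot w
TypeII-EndsBot (_ , _ , _ , _ , _ , _ , _ , _ , _ , _ , refl) = _ , refl

TypeII-dot<h : ∀ {Φ NT T} {r : Rule Φ NT T} {h τ L w} → TypeII r h τ L w →
               ∀ {d} → d + 2 ≤ length w → d < toℕ h
TypeII-dot<h {h = h} q {d} d+2≤ =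
  ≤-pred (subst (_≤ suc (toℕ h)) (+-comm d 2) (≤-trans d+2≤ (TypeII-length-≤ q)))

module _ {G : PLL} {D : List (Alph G)} where

  CoveredAt : {N : NT G} {α β : Φ G} {w : List (ISym (Φ G) (NT G) (T G))} →
              InducedRule G (node N α β) w → ℕ → Set
  CoveredAt {N} {α} {β} {w} q∈ d =
    ∀ i j (d≤ : d ≤ length w) (i≤j : i ≤ j) (j≤ : j ≤ length D) →
    Σ (PItem G D) λ x → (lhs (PItem.r x) ≡ N) × InBar (mkO (node N α β) w q∈ d d≤ i j i≤j j≤) x

  TypeI-covered : ∀ {r N α β t w} → ℜ G r → (q : TypeI r t (node N α β) w)
                  (q∈ : InducedRule G (node N α β) w) → ∀ d → CoveredAt q∈ d
  TypeI-covered {r} {t = t} r∈ q@(_ , mid , _ , _ , t∈ , refl , refl) q∈ d i j d≤ i≤j j≤ =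
    mkP r r∈ d d≤k i j i≤j j≤ (take (2 * suc d) t) (InAngle-take {r = r} {ρ = t} t∈ (s≤s d≤k)) ,
    refl , refl , refl , refl , inj₁ (t , q , refl)
    where
    d≤k : d ≤ length (rhs r)
    d≤k = ≤-trans d≤ (length-decorate-≤ (rhs r) mid)

  TypeII-covered : ∀ {r h N α β τ w} → ℜ G r → (q : TypeII r h τ (node N α β) w)
                   (q∈ : InducedRule G (node N α β) w) → ∀ d → d < toℕ h → CoveredAt q∈ d
  TypeII-covered {r} {h} {τ = τ} r∈ q@(_ , _ , _ , _ , _ , _ , _ , τ∈ , _ , refl , _) q∈ d d<h i j _ i≤j j≤ =
    mkP r r∈ d d≤k i j i≤j j≤ (take (2 * suc d) τ) (InAngle-take {r = r} {ρ = τ} τ∈ d<h) ,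
    refl , refl , refl , refl , inj₂ (h , τ , q , d<h , refl)
    where
    d≤k : d ≤ length (rhs r)
    d≤k = ≤-trans (<⇒≤ d<h) (≤-pred (toℕ<n h))

theorem5 : (G : PLL) (D : List (Alph G)) (N : NT G) (α β : Φ G)
    (w : List (ISym (Φ G) (NT G) (T G)))
    (q∈ : InducedRule G (node N α β) w) →
    (EndsBot w → 2 ≤ length w) ×
    ((d i j : ℕ) (d≤ : d ≤ length w) → (EndsBot w → d + 2 ≤ length w) →
      (i≤j : i ≤ j) (j≤ : j ≤ length D) →
      Σ (PItem G D) λ x → (lhs (PItem.r x) ≡ N) ×
        InBar (mkO (node N α β) w q∈ d d≤ i j i≤j j≤) x)
theorem5 G D N α β w (inj₁ (() , _))
theorem5 G D N α β w q∈@(inj₂ (r , r∈ , inj₁ (t , q))) =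
  (λ ends⊥ → ⊥-elim (TypeI-¬EndsBot q ends⊥)) ,
  λ d i j d≤ _ → TypeI-covered r∈ q q∈ d i j d≤
theorem5 G D N α β w q∈@(inj₂ (r , r∈ , inj₂ (h , τ , q))) =
  (λ _ → TypeII-length-≥2 q) ,
  λ d i j d≤ d+2≤ → TypeII-covered r∈ q q∈ d (TypeII-dot<h q (d+2≤ (TypeII-EndsBot q))) i j d≤
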